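{- Let $T$ be a finite tree in which every vertex has degree at most $3$, and let $p$ be the number of leaves of $T$. Then $T$ contains $\lfloor p/2\rfloor$ pairwise vertex-disjoint paths, each of which starts and ends at (distinct) leaves of $T$.
   Context: A leaf is a vertex of degree $1$. A graph is subcubic if all its vertices have degree at most $3$. -}

module Defs where

open import Data.Nat using (ℕ; _+_; _/_; _≟_; _≤_)
open import Data.Nat.ListAction using (sum)
open import Data.Sum using (_⊎_)
open import Data.Bool using (Bool; true; false; if_then_else_)
open import Data.Fin using (Fin)
open import Data.List using (List; []; _∷_; _++_; allFin; map; length)
open import Data.List.Relation.Unary.Linked using (Linked)
open import Data.List.Relation.Unary.Unique.Propositional using (Unique)
open import Data.List.Relation.Unary.All using (All)
open import Data.List.Relation.Unary.AllPairs using (AllPairs)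
open import Data.List.Membership.Propositional using (_∈_)
open import Data.Product using (Σ; ∃; _×_; _,_)
open import Data.Empty using (⊥)
open import Relation.Binary.PropositionalEquality using (_≡_)
open import Relation.Nullary.Decidable using (⌊_⌋)

record Graph (n : ℕ) : Set where
  field
    adj     : Fin n → Fin n → Bool
    adj-sym : ∀ u v → adj u v ≡ adj v u
    adj-irr : ∀ v → adj v v ≡ false

module _ {n : ℕ} (G : Graph n) where
  open Graph G

  Adj : Fin n → Fin n → Set
  Adj u v = adj u v ≡ true

  degree : Fin n → ℕ
  degree v = sum (map (λ u → if adj v u then 1 else 0) (allFin n))

  Subcubic : Set
  Subcubic = ∀ v → degree v ≤ 3

  IsLeaf : Fin n → Set
  IsLeaf v = degree v ≡ 1

  leafCount : ℕ
  leafCount = sum (map (λ v → if ⌊ degree v ≟ 1 ⌋ then 1 else 0) (allFin n))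

  IsPath : List (Fin n) → Set
  IsPath xs = Linked Adj xs × Unique xs

  PathBetween : Fin n → Fin n → List (Fin n) → Set
  PathBetween u v xs =
    IsPath xs × ((xs ≡ u ∷ [] × u ≡ v) ⊎ (Σ (List (Fin n)) λ mid → xs ≡ u ∷ mid ++ v ∷ []))

  Connected : Set
  Connected = ∀ u v → ∃ λ xs → PathBetween u v xs

  IsCycle : List (Fin n) → Set
  IsCycle (x ∷ y ∷ z ∷ rest) =
    Unique (x ∷ y ∷ z ∷ rest) × Linked Adj (x ∷ y ∷ z ∷ rest ++ x ∷ [])
  IsCycle _ = ⊥

  Acyclic : Set
  Acyclic = ∀ xs → IsCycle xs → ⊥

  IsTree : Set
  IsTree = Connected × Acyclic

  LeafToLeafPath : List (Fin n) → Set
  LeafToLeafPath xs = Σ (Fin n) λ u → Σ (Fin n) λ v → Σ (List (Fin n)) λ mid →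
    xs ≡ u ∷ mid ++ v ∷ [] × IsPath xs × IsLeaf u × IsLeaf v

Disjoint : {n : ℕ} → List (Fin n) → List (Fin n) → Set
Disjoint xs ys = ∀ x → x ∈ xs → x ∈ ys → ⊥

-- Induction on the degree sum, deleting leaf edges. The statement is strengthened: when the number
-- p of leaves is odd, a prescribed leaf x may be left off all paths.
-- If p is odd, delete the edge ℓu at a leaf ℓ (chosen to be x). If u had degree 3, p drops by one
-- and ⌊p/2⌋ is unchanged; if u had degree 2, u becomes a leaf, p is unchanged, and paths for the
-- smaller tree that avoid u are leaf-to-leaf paths of T; u is no leaf, or T would be the edge ℓu.
-- If p is even, walking from a leaf through vertices of degree ≥ 2 (a tree has no cycles) ends at
-- a leaf ℓ whose neighbour u has degree ≤ 2, or at two leaves ℓ, a with a common neighbour u of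
-- degree 3. In the first case delete ℓu and either add the path ℓu or prolong through ℓ the path
-- ending at the new leaf u; in the second delete ℓu and au, take paths avoiding the new leaf u
-- (p − 1 is odd), and add the path ℓua.

module Submission where

open import Defs
open import Data.Nat
  using (ℕ; zero; suc; _+_; _/_; _≤_; _<_; z≤n; s≤s; s≤s⁻¹; _≟_; _≤?_; ⌊_/2⌋; parity)
open import Data.Parity.Base using (0ℙ; 1ℙ; _⁻¹)
open import Data.Parity.Properties using (suc-homo-⁻¹)
open import Data.Nat.Properties
open import Data.Nat.DivMod using (m/n≡1+[m∸n]/n)
open import Data.Nat.ListAction using (sum)
open import Data.Bool using (true; false; if_then_else_; _∧_; not)
open import Data.Bool.Properties using (∧-identityʳ; ∧-zeroʳ) renaming (_≟_ to _≟ᵇ_)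
open import Data.Fin as Fin using (Fin) renaming (_≟_ to _≟ᶠ_)
open import Data.Fin.Properties using (any?)
open import Data.List using (List; []; _∷_; _++_; allFin; map; length)
open import Data.List.Properties using (length-++-sucʳ; length-tabulate)
open import Data.List.Membership.Propositional using (_∈_; _∉_)
open import Data.List.Membership.Propositional.Properties using (∈-allFin; ∈-∃++; ∈-++⁻; ∈-++⁺ʳ)
open import Data.List.Relation.Unary.Any using (here; there)
open import Data.List.Relation.Unary.All as All using (All; []; _∷_)
open import Data.List.Relation.Unary.AllPairs using (AllPairs; []; _∷_)
open import Data.List.Relation.Unary.Unique.Propositional using (Unique)
open import Data.List.Relation.Unary.Unique.Propositional.Properties as Unique using (allFin⁺; Unique[x∷xs]⇒x∉xs)
open import Data.List.Relation.Binary.Pointwise using (Pointwise; []; _∷_; Pointwise-length)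
open import Data.List.Relation.Unary.Linked as Linked using (Linked; []; [-]; _∷_)
open import Data.Product using (Σ; ∃; _×_; _,_; proj₁; proj₂)
import Data.Product as Product
import Data.Sum as Sum
open import Data.Sum using (_⊎_; inj₁; inj₂)
open import Data.Empty using (⊥)
open import Function using (_∘_)
open import Function.Bundles using (mk⇔)
open import Relation.Binary.Definitions using (DecidableEquality)
open import Relation.Nullary using (¬_; Dec; yes; no; does; contradiction)
open import Relation.Nullary.Decidable using (⌊_⌋; dec-true; dec-false; does-⇔; _×-dec_; _⊎-dec_; ¬?)
open import Relation.Binary.PropositionalEquality
open import Algebra.Properties.CommutativeSemigroup +-commutativeSemigroup using (x∙yz≈y∙xz)

module Sums {A : Set} (_≟A_ : DecidableEquality A) where

  zeroAt : A → (A → ℕ) → A → ℕ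
  zeroAt a h x = if does (x ≟A a) then 0 else h x

  zeroAt-≡ : ∀ a h → zeroAt a h a ≡ 0
  zeroAt-≡ a h rewrite dec-true (a ≟A a) refl = refl

  zeroAt-≢ : ∀ {a x} h → x ≢ a → zeroAt a h x ≡ h x
  zeroAt-≢ {a} {x} h x≢a rewrite dec-false (x ≟A a) x≢a = refl

  sum-map-cong : ∀ xs {h g : A → ℕ} → (∀ x → x ∈ xs → h x ≡ g x) →
                 sum (map h xs) ≡ sum (map g xs)
  sum-map-cong []       h≡g = refl
  sum-map-cong (x ∷ xs) h≡g = cong₂ _+_ (h≡g x (here refl)) (sum-map-cong xs (λ y → h≡g y ∘ there))

  sum-map-zeroAt-∉ : ∀ {xs a} h → a ∉ xs → sum (map (zeroAt a h) xs) ≡ sum (map h xs)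
  sum-map-zeroAt-∉ {xs} h a∉xs = sum-map-cong xs λ y y∈xs → zeroAt-≢ h λ { refl → a∉xs y∈xs }

  sum-map-split : ∀ {xs a} h → Unique xs → a ∈ xs →
                  sum (map h xs) ≡ h a + sum (map (zeroAt a h) xs)
  sum-map-split {x ∷ xs} h unique (here refl) =
    cong (h x +_) (sym (cong₂ _+_ (zeroAt-≡ x h) (sum-map-zeroAt-∉ h (Unique[x∷xs]⇒x∉xs unique))))
  sum-map-split {x ∷ xs} {a} h (x∉xs ∷ u) (there a∈xs) = begin
    h x + sum (map h xs)                                  ≡⟨ cong (h x +_) (sum-map-split h u a∈xs) ⟩
    h x + (h a + sum (map (zeroAt a h) xs))               ≡⟨ x∙yz≈y∙xz (h x) (h a) _ ⟩
    h a + (h x + sum (map (zeroAt a h) xs))               ≡⟨ cong (λ z → h a + (z + _)) (zeroAt-≢ h x≢a) ⟨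
    h a + (zeroAt a h x + sum (map (zeroAt a h) xs))      ∎
    where
    open ≡-Reasoning
    x≢a : x ≢ a
    x≢a = All.lookup x∉xs a∈xs

  sum-map-mono : ∀ xs {h g : A → ℕ} → (∀ x → h x ≤ g x) → sum (map h xs) ≤ sum (map g xs)
  sum-map-mono []       h≤g = z≤n
  sum-map-mono (x ∷ xs) h≤g = +-mono-≤ (h≤g x) (sum-map-mono xs h≤g)

  sum-map≢0 : ∀ xs h → sum (map h xs) ≢ 0 → Σ A λ x → h x ≢ 0
  sum-map≢0 []       h s≢0 = contradiction refl s≢0
  sum-map≢0 (x ∷ xs) h s≢0 with h x ≟ 0
  ... | no hx≢0 = x , hx≢0
  ... | yes hx≡0 = sum-map≢0 xs h (s≢0 ∘ cong₂ _+_ hx≡0)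

module _ {A : Set} where

  Linked-hasNeighbour : ∀ {R : A → A → Set} {s t x} mid → Linked R (s ∷ mid ++ t ∷ []) →
                        x ∈ s ∷ mid ++ t ∷ [] → ∃ λ z → R x z ⊎ R z x
  Linked-hasNeighbour {t = t} []    (st ∷ _) (here refl)         = t , inj₁ st
  Linked-hasNeighbour {s = s} []    (st ∷ _) (there (here refl)) = s , inj₂ st
  Linked-hasNeighbour (m ∷ _)       (sm ∷ _) (here refl)         = m , inj₁ sm
  Linked-hasNeighbour (_ ∷ mid)     (_ ∷ l)  (there x∈)          = Linked-hasNeighbour mid l x∈

  Linked-step : ∀ {R : A → A → Set} {m t} ys → Linked R (m ∷ ys ++ t ∷ []) →
                ∃ λ z → R m z × z ∈ ys ++ t ∷ []
  Linked-step []      (mz ∷ _) = _ , mz , here refl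
  Linked-step (_ ∷ _) (mz ∷ _) = _ , mz , here refl

  Linked-interior : ∀ {R : A → A → Set} {s t x} mid → Linked R (s ∷ mid ++ t ∷ []) →
                    Unique (s ∷ mid ++ t ∷ []) → x ∈ mid → ∃ λ y → ∃ λ z → R y x × R x z × y ≢ z
  Linked-interior {s = s} (_ ∷ mid) (sm ∷ l) (s∉ ∷ _) (here refl) with Linked-step mid l
  ... | z , mz , z∈ = s , z , sm , mz , All.lookup s∉ (there z∈)
  Linked-interior (_ ∷ mid) (_ ∷ l) (_ ∷ u) (there x∈) = Linked-interior mid l u x∈

  ∈-endpoints : ∀ {s t x : A} mid → x ∈ s ∷ mid ++ t ∷ [] → x ≡ s ⊎ x ∈ mid ⊎ x ≡ t
  ∈-endpoints mid (here x≡s) = inj₁ x≡s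
  ∈-endpoints mid (there x∈) with ∈-++⁻ mid x∈
  ... | inj₁ x∈mid         = inj₂ (inj₁ x∈mid)
  ... | inj₂ (here x≡t)    = inj₂ (inj₂ x≡t)

  Linked-restrict : ∀ {R S : A → A → Set} {P : A → Set} → (∀ {x y} → P x → P y → R x y → S x y) →
                    ∀ {xs} → All P xs → Linked R xs → Linked S xs
  Linked-restrict f _                []      = []
  Linked-restrict f _                [-]     = [-]
  Linked-restrict f (px ∷ py ∷ pxs) (r ∷ l) = f px py r ∷ Linked-restrict f (py ∷ pxs) l

  Linked-snoc : ∀ {R : A → A → Set} xs {t w} → Linked R (xs ++ t ∷ []) → R t w →
                Linked R ((xs ++ t ∷ []) ++ w ∷ [])
  Linked-snoc []           [-]      tw = tw ∷ [-]
  Linked-snoc (_ ∷ [])     (r ∷ [-]) tw = r ∷ tw ∷ [-]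
  Linked-snoc (_ ∷ y ∷ xs) (r ∷ l)  tw = r ∷ Linked-snoc (y ∷ xs) l tw

  Unique-snoc : ∀ {xs} {w : A} → Unique xs → w ∉ xs → Unique (xs ++ w ∷ [])
  Unique-snoc unique w∉xs = Unique.++⁺ unique ([] ∷ []) λ { (w∈xs , here refl) → w∉xs w∈xs }

  Linked-prefix : ∀ {R : A → A → Set} xs {w ys} → Linked R (xs ++ w ∷ ys) → Linked R (xs ++ w ∷ [])
  Linked-prefix []           _       = [-]
  Linked-prefix (_ ∷ [])     (r ∷ _) = r ∷ [-]
  Linked-prefix (_ ∷ y ∷ xs) (r ∷ l) = r ∷ Linked-prefix (y ∷ xs) l

  Unique-prefix : ∀ xs {w : A} {ys} → Unique (xs ++ w ∷ ys) → Unique (xs ++ w ∷ [])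
  Unique-prefix []       (_ ∷ _)    = [] ∷ []
  Unique-prefix (x ∷ xs) (x∉ ∷ u) = prefix xs x∉ ∷ Unique-prefix xs u
    where
    prefix : ∀ {P : A → Set} xs {w ys} → All P (xs ++ w ∷ ys) → All P (xs ++ w ∷ [])
    prefix []       (p ∷ _)  = p ∷ []
    prefix (_ ∷ xs) (p ∷ ps) = p ∷ prefix xs ps

  AllPairs-pointwise : ∀ {B : Set} {R : A → A → Set} {S : B → B → Set} {T : B → A → Set} →
                       (∀ {a b c d} → T c a → T d b → R a b → S c d) →
                       ∀ {ys xs} → Pointwise T ys xs → AllPairs R xs → AllPairs S ys
  AllPairs-pointwise f []       []         = []
  AllPairs-pointwise f (t ∷ ts) (r ∷ rs) = transport ts r ∷ AllPairs-pointwise f ts rs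
    where
    transport : ∀ {ys′ xs′} → Pointwise _ ys′ xs′ → All _ xs′ → All _ ys′
    transport []         []         = []
    transport (t′ ∷ ts′) (r′ ∷ rs′) = f t t′ r′ ∷ transport ts′ rs′

  Unique-length≤ : ∀ (ws xs : List A) → Unique ws → (∀ {x} → x ∈ ws → x ∈ xs) →
                   length ws ≤ length xs
  Unique-length≤ []       xs _          _  = z≤n
  Unique-length≤ (w ∷ ws) xs (w∉ ∷ u) ws⊆xs with ∈-∃++ (ws⊆xs (here refl))
  ... | ys , zs , refl = begin
    suc (length ws)                 ≤⟨ s≤s (Unique-length≤ ws (ys ++ zs) u ws⊆ys++zs) ⟩
    suc (length (ys ++ zs))         ≡⟨ length-++-sucʳ ys w zs ⟨
    length (ys ++ w ∷ zs)           ∎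
    where
    open ≤-Reasoning
    delete : ∀ ys {x} → x ∈ ys ++ w ∷ zs → x ≢ w → x ∈ ys ++ zs
    delete []       (here x≡w) x≢w = contradiction x≡w x≢w
    delete []       (there x∈) _   = x∈
    delete (_ ∷ ys) (here x≡y) _   = here x≡y
    delete (_ ∷ ys) (there x∈) x≢w = there (delete ys x∈ x≢w)
    ws⊆ys++zs : ∀ {x} → x ∈ ws → x ∈ ys ++ zs
    ws⊆ys++zs x∈ws = delete ys (ws⊆xs (there x∈ws)) (λ { refl → All.lookup w∉ x∈ws refl })

⌊1+n/2⌋-even : ∀ n → parity n ≡ 0ℙ → ⌊ suc n /2⌋ ≡ ⌊ n /2⌋
⌊1+n/2⌋-even zero          _ = refl
⌊1+n/2⌋-even (suc (suc n)) p = cong suc (⌊1+n/2⌋-even n p)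

⌊1+n/2⌋-odd : ∀ n → parity n ≡ 1ℙ → ⌊ suc n /2⌋ ≡ suc ⌊ n /2⌋
⌊1+n/2⌋-odd (suc zero)    _ = refl
⌊1+n/2⌋-odd (suc (suc n)) p = cong suc (⌊1+n/2⌋-odd n p)

parity-pred : ∀ {m n} → m ≡ suc n → parity n ≡ parity m ⁻¹
parity-pred {n = n} refl = sym (suc-homo-⁻¹ n)

⌊n/2⌋≡n/2 : ∀ n → ⌊ n /2⌋ ≡ n / 2
⌊n/2⌋≡n/2 zero          = refl
⌊n/2⌋≡n/2 (suc zero)    = refl
⌊n/2⌋≡n/2 (suc (suc n)) =
  trans (cong suc (⌊n/2⌋≡n/2 n)) (sym (m/n≡1+[m∸n]/n {suc (suc n)} {2} (s≤s (s≤s z≤n))))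

module _ {n : ℕ} where
  open Sums (_≟ᶠ_ {n}) public

  total : (Fin n → ℕ) → ℕ
  total h = sum (map h (allFin n))

  total-cong : ∀ {h g} → (∀ x → h x ≡ g x) → total h ≡ total g
  total-cong h≡g = sum-map-cong (allFin n) (λ x _ → h≡g x)

  total-split : ∀ a h → total h ≡ h a + total (zeroAt a h)
  total-split a h = sum-map-split h (allFin⁺ n) (∈-allFin a)

  total-mono : ∀ {h g} → (∀ x → h x ≤ g x) → total h ≤ total g
  total-mono = sum-map-mono (allFin n)

  total-mono-< : ∀ {h g} a → (∀ x → h x ≤ g x) → h a < g a → total h < total g
  total-mono-< {h} {g} a h≤g ha<ga = begin-strict
    total h                      ≡⟨ total-split a h ⟩
    h a + total (zeroAt a h)     <⟨ +-mono-<-≤ ha<ga (total-mono zeroAt-h≤g) ⟩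
    g a + total (zeroAt a g)     ≡⟨ total-split a g ⟨
    total g                      ∎
    where
    open ≤-Reasoning
    zeroAt-h≤g : ∀ x → zeroAt a h x ≤ zeroAt a g x
    zeroAt-h≤g x with does (x ≟ᶠ a)
    ... | true  = z≤n
    ... | false = h≤g x

  term≤total : ∀ a h → h a ≤ total h
  term≤total a h = ≤-trans (m≤m+n (h a) _) (≤-reflexive (sym (total-split a h)))

  total≢0 : ∀ h → total h ≢ 0 → ∃ λ x → h x ≢ 0
  total≢0 = sum-map≢0 (allFin n)

  totalOff : Fin n → Fin n → (Fin n → ℕ) → ℕ
  totalOff a b h = total (zeroAt b (zeroAt a h))

  total-split₂ : ∀ {a b} → a ≢ b → ∀ h → total h ≡ h a + h b + totalOff a b h
  total-split₂ {a} {b} a≢b h = begin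
    total h                                           ≡⟨ total-split a h ⟩
    h a + total (zeroAt a h)                          ≡⟨ cong (h a +_) (total-split b (zeroAt a h)) ⟩
    h a + (zeroAt a h b + totalOff a b h)
      ≡⟨ cong (λ z → h a + (z + totalOff a b h)) (zeroAt-≢ h (a≢b ∘ sym)) ⟩
    h a + (h b + totalOff a b h)                      ≡⟨ +-assoc (h a) (h b) _ ⟨
    h a + h b + totalOff a b h                        ∎
    where open ≡-Reasoning

  totalOff-cong : ∀ {a b h g} → (∀ x → x ≢ a → x ≢ b → h x ≡ g x) → totalOff a b h ≡ totalOff a b g
  totalOff-cong {a} {b} {h} {g} h≡g = total-cong pointwise
    where
    pointwise : ∀ x → zeroAt b (zeroAt a h) x ≡ zeroAt b (zeroAt a g) x
    pointwise x with x ≟ᶠ b | x ≟ᶠ a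
    ... | yes _   | _       = refl
    ... | no _    | yes _   = refl
    ... | no x≢b  | no x≢a  = h≡g x x≢a x≢b

module _ {n : ℕ} (G : Graph n) where
  open Graph G

  adjInd : Fin n → Fin n → ℕ
  adjInd v u = if adj v u then 1 else 0

  Adj-sym : ∀ {u v} → Adj G u v → Adj G v u
  Adj-sym {u} {v} uv = trans (adj-sym v u) uv

  Adj-irrefl : ∀ {u v} → Adj G u v → u ≢ v
  Adj-irrefl {u} uu refl with trans (sym uu) (adj-irr u)
  ... | ()

  adjInd-Adj : ∀ {v u} → Adj G v u → adjInd v u ≡ 1
  adjInd-Adj vu rewrite vu = refl

  adjInd≢0⇒Adj : ∀ {v u} → adjInd v u ≢ 0 → Adj G v u
  adjInd≢0⇒Adj {v} {u} ind≢0 with adj v u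
  ... | true  = refl
  ... | false = contradiction refl ind≢0

  Adj⇒1≤degree : ∀ {v u} → Adj G v u → 1 ≤ degree G v
  Adj⇒1≤degree {v} {u} vu = ≤-trans (≤-reflexive (sym (adjInd-Adj vu))) (term≤total u (adjInd v))

  1≤degree⇒Adj : ∀ {v} → 1 ≤ degree G v → ∃ (Adj G v)
  1≤degree⇒Adj {v} 1≤d with total≢0 (adjInd v) (λ d≡0 → <⇒≢ 1≤d (sym d≡0))
  ... | u , ind≢0 = u , adjInd≢0⇒Adj ind≢0

SameEdge : ∀ {n} → Fin n → Fin n → Fin n → Fin n → Set
SameEdge a b x y = (x ≡ a × y ≡ b) ⊎ (x ≡ b × y ≡ a)

sameEdge? : ∀ {n} (a b x y : Fin n) → Dec (SameEdge a b x y)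
sameEdge? a b x y = (x ≟ᶠ a ×-dec y ≟ᶠ b) ⊎-dec (x ≟ᶠ b ×-dec y ≟ᶠ a)

SameEdge-swap : ∀ {n} {a b x y : Fin n} → SameEdge a b x y → SameEdge a b y x
SameEdge-swap = Sum.swap ∘ Sum.map Product.swap Product.swap

deleteEdge : ∀ {n} → Graph n → Fin n → Fin n → Graph n
deleteEdge G a b = record
  { adj     = λ x y → adj x y ∧ not (does (sameEdge? a b x y))
  ; adj-sym = λ x y → cong₂ (λ p q → p ∧ not q) (adj-sym x y)
                        (does-⇔ (mk⇔ SameEdge-swap SameEdge-swap) (sameEdge? a b x y) (sameEdge? a b y x))
  ; adj-irr = λ v → cong (_∧ not (does (sameEdge? a b v v))) (adj-irr v)
  }
  where open Graph G

SameEdge-unique : ∀ {n} {a b v w y : Fin n} → a ≢ b → SameEdge a b v w → SameEdge a b v y → y ≡ w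
SameEdge-unique a≢b (inj₁ (refl , refl)) (inj₁ (_ , refl))    = refl
SameEdge-unique a≢b (inj₁ (refl , refl)) (inj₂ (a≡b , _))     = contradiction a≡b a≢b
SameEdge-unique a≢b (inj₂ (refl , refl)) (inj₁ (b≡a , _))     = contradiction (sym b≡a) a≢b
SameEdge-unique a≢b (inj₂ (refl , refl)) (inj₂ (_ , refl))    = refl

module _ {n : ℕ} (G : Graph n) (a b : Fin n) where
  private
    R = deleteEdge G a b

  adj-deleteEdge-off : ∀ {x y} → ¬ SameEdge a b x y → Graph.adj R x y ≡ Graph.adj G x y
  adj-deleteEdge-off {x} {y} ¬e rewrite dec-false (sameEdge? a b x y) ¬e = ∧-identityʳ _

  adj-deleteEdge-on : ∀ {x y} → SameEdge a b x y → Graph.adj R x y ≡ false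
  adj-deleteEdge-on {x} {y} e rewrite dec-true (sameEdge? a b x y) e = ∧-zeroʳ _

  deleteEdge-⊆ : ∀ {x y} → Adj R x y → Adj G x y
  deleteEdge-⊆ {x} {y} xy with Graph.adj G x y
  ... | true  = refl
  ... | false = xy

  deleteEdge-keeps : ∀ {x y} → ¬ SameEdge a b x y → Adj G x y → Adj R x y
  deleteEdge-keeps ¬e xy = trans (adj-deleteEdge-off ¬e) xy

  deleteEdge-removes : ∀ {x y} → SameEdge a b x y → ¬ Adj R x y
  deleteEdge-removes e xy with trans (sym xy) (adj-deleteEdge-on e)
  ... | ()

  degree-deleteEdge-≤ : ∀ x → degree R x ≤ degree G x
  degree-deleteEdge-≤ x = total-mono λ y → ind≤ (Graph.adj G x y) (does (sameEdge? a b x y))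
    where
    ind≤ : ∀ p q → (if p ∧ not q then 1 else 0) ≤ (if p then 1 else 0)
    ind≤ true  true  = z≤n
    ind≤ true  false = ≤-refl
    ind≤ false _     = z≤n

  degree-deleteEdge-off : ∀ {x} → x ≢ a → x ≢ b → degree R x ≡ degree G x
  degree-deleteEdge-off {x} x≢a x≢b =
    total-cong λ y → cong (if_then 1 else 0) (adj-deleteEdge-off {x} {y} Sum.[ x≢a ∘ proj₁ , x≢b ∘ proj₁ ])

  degree-deleteEdge-endpoint : ∀ {v w} → SameEdge a b v w → Adj G v w → degree G v ≡ suc (degree R v)
  degree-deleteEdge-endpoint {v} {w} e vw = begin
    degree G v                                  ≡⟨ total-split w (adjInd G v) ⟩
    adjInd G v w + total (zeroAt w (adjInd G v)) ≡⟨ cong₂ _+_ (adjInd-Adj G vw) (total-cong off-w) ⟩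
    1 + total (zeroAt w (adjInd R v))            ≡⟨ cong (λ i → suc (i + total (zeroAt w (adjInd R v)))) removed ⟨
    suc (adjInd R v w + total (zeroAt w (adjInd R v))) ≡⟨ cong suc (total-split w (adjInd R v)) ⟨
    suc (degree R v)                            ∎
    where
    open ≡-Reasoning
    removed : adjInd R v w ≡ 0
    removed = cong (if_then 1 else 0) (adj-deleteEdge-on e)
    a≢b : a ≢ b
    a≢b = Sum.[ (λ { (refl , refl) → Adj-irrefl G vw }) , (λ { (refl , refl) → Adj-irrefl G vw ∘ sym }) ] e
    off-w : ∀ y → zeroAt w (adjInd G v) y ≡ zeroAt w (adjInd R v) y
    off-w y with y ≟ᶠ w
    ... | yes _   = refl
    ... | no y≢w = sym (cong (if_then 1 else 0) (adj-deleteEdge-off (y≢w ∘ SameEdge-unique a≢b e)))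

  degree-deleteEdge-start : Adj G a b → degree G a ≡ suc (degree R a)
  degree-deleteEdge-start = degree-deleteEdge-endpoint (inj₁ (refl , refl))

  degree-deleteEdge-end : Adj G a b → degree G b ≡ suc (degree R b)
  degree-deleteEdge-end ab = degree-deleteEdge-endpoint (inj₂ (refl , refl)) (Adj-sym G ab)

module _ {n : ℕ} where

  private
    ¬SameEdge-otherNeighbour : ∀ (G : Graph n) {v a b} → Adj G v a → b ≢ a → ¬ SameEdge v a v b
    ¬SameEdge-otherNeighbour G va b≢a (inj₁ (_ , b≡a))  = b≢a b≡a
    ¬SameEdge-otherNeighbour G va b≢a (inj₂ (v≡a , _))  = Adj-irrefl G va v≡a

    keptNeighbour : ∀ (G : Graph n) {v a b} → Adj G v a → Adj G v b → b ≢ a → Adj (deleteEdge G v a) v b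
    keptNeighbour G va vb b≢a = deleteEdge-keeps G _ _ (¬SameEdge-otherNeighbour G va b≢a) vb

  Adj⇒2≤degree : ∀ (G : Graph n) {v a b} → Adj G v a → Adj G v b → b ≢ a → 2 ≤ degree G v
  Adj⇒2≤degree G va vb b≢a = subst (2 ≤_) (sym (degree-deleteEdge-start G _ _ va))
    (s≤s (Adj⇒1≤degree (deleteEdge G _ _) (keptNeighbour G va vb b≢a)))

  anotherNeighbour : ∀ (G : Graph n) {v a} → 2 ≤ degree G v → Adj G v a → ∃ λ b → b ≢ a × Adj G v b
  anotherNeighbour G {v} {a} 2≤d va with 1≤degree⇒Adj (deleteEdge G v a)
    (s≤s⁻¹ (subst (2 ≤_) (degree-deleteEdge-start G v a va) 2≤d))
  ... | b , vb = b , (λ { refl → deleteEdge-removes G v a (inj₁ (refl , refl)) vb }) , deleteEdge-⊆ G v a vb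

  thirdNeighbour : ∀ (G : Graph n) {v a b} → 3 ≤ degree G v → Adj G v a → Adj G v b → b ≢ a →
                   ∃ λ c → c ≢ a × c ≢ b × Adj G v c
  thirdNeighbour G {v} {a} {b} 3≤d va vb b≢a
    with anotherNeighbour (deleteEdge G v a) (s≤s⁻¹ (subst (3 ≤_) (degree-deleteEdge-start G v a va) 3≤d))
                          (keptNeighbour G va vb b≢a)
  ... | c , c≢b , vc =
    c , (λ { refl → deleteEdge-removes G v a (inj₁ (refl , refl)) vc }) , c≢b , deleteEdge-⊆ G v a vc

  leaf-neighbour-unique : ∀ (G : Graph n) {v a b} → IsLeaf G v → Adj G v a → Adj G v b → b ≡ a
  leaf-neighbour-unique G {v} {a} {b} leaf va vb with b ≟ᶠ a
  ... | yes b≡a = b≡a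
  ... | no b≢a  = contradiction (subst (2 ≤_) leaf (Adj⇒2≤degree G va vb b≢a)) λ { (s≤s ()) }

module _ {n : ℕ} where

  _⊆ᴳ_ : Graph n → Graph n → Set
  R ⊆ᴳ G = ∀ {x y} → Adj R x y → Adj G x y

  Acyclic-⊆ : ∀ {R G} → R ⊆ᴳ G → Acyclic G → Acyclic R
  Acyclic-⊆ R⊆G acyclic (x ∷ y ∷ z ∷ rest) (u , l) = acyclic (x ∷ y ∷ z ∷ rest) (u , Linked.map R⊆G l)

  interior-2≤degree : ∀ (G : Graph n) {s t x} mid → IsPath G (s ∷ mid ++ t ∷ []) → x ∈ mid →
                      2 ≤ degree G x
  interior-2≤degree G mid (l , u) x∈ with Linked-interior mid l u x∈
  ... | y , z , yx , xz , y≢z = Adj⇒2≤degree G (Adj-sym G yx) xz (y≢z ∘ sym)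

  isolated∉LeafToLeafPath : ∀ (G : Graph n) {x P} → degree G x ≡ 0 → LeafToLeafPath G P → x ∉ P
  isolated∉LeafToLeafPath G d≡0 (_ , _ , mid , refl , (l , _) , _) x∈ =
    contradiction (subst (1 ≤_) d≡0 1≤degree) λ ()
    where
    1≤degree : 1 ≤ degree G _
    1≤degree with Linked-hasNeighbour mid l x∈
    ... | _ , inj₁ xz = Adj⇒1≤degree G xz
    ... | _ , inj₂ zx = Adj⇒1≤degree G (Adj-sym G zx)

  private
    leaf≱2 : ∀ (G : Graph n) {v} → IsLeaf G v → ¬ (2 ≤ degree G v)
    leaf≱2 G leaf 2≤d with subst (2 ≤_) leaf 2≤d
    ... | s≤s ()

  leaf∈path⇒endpoint : ∀ (G : Graph n) {ℓ s t xs} → IsLeaf G ℓ → PathBetween G s t xs → ℓ ∈ xs →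
                       ℓ ≡ s ⊎ ℓ ≡ t
  leaf∈path⇒endpoint G leaf (_ , inj₁ (refl , _)) (here ℓ≡s) = inj₁ ℓ≡s
  leaf∈path⇒endpoint G leaf (p , inj₂ (mid , refl)) ℓ∈ with ∈-endpoints mid ℓ∈
  ... | inj₁ ℓ≡s          = inj₁ ℓ≡s
  ... | inj₂ (inj₂ ℓ≡t)   = inj₂ ℓ≡t
  ... | inj₂ (inj₁ ℓ∈mid) = contradiction (interior-2≤degree G mid p ℓ∈mid) (leaf≱2 G leaf)

  adjacentLeaves-path : ∀ (G : Graph n) {ℓ u y xs} → IsLeaf G ℓ → IsLeaf G u → Adj G ℓ u →
                        PathBetween G ℓ y xs → y ≡ ℓ ⊎ y ≡ u
  adjacentLeaves-path G ℓ-leaf u-leaf ℓu (_ , inj₁ (_ , ℓ≡y)) = inj₁ (sym ℓ≡y)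
  adjacentLeaves-path G ℓ-leaf u-leaf ℓu ((ℓy ∷ _ , _) , inj₂ ([] , refl)) =
    inj₂ (leaf-neighbour-unique G ℓ-leaf ℓu ℓy)
  adjacentLeaves-path G ℓ-leaf u-leaf ℓu (p@(ℓm ∷ _ , _) , inj₂ (m ∷ mid , refl))
    with leaf-neighbour-unique G ℓ-leaf ℓu ℓm
  ... | refl = contradiction (interior-2≤degree G (m ∷ mid) p (here refl)) (leaf≱2 G u-leaf)

  LeafToLeafPath-lift : ∀ {R G : Graph n} {P} → R ⊆ᴳ G → (∀ {v} → v ∈ P → IsLeaf R v → IsLeaf G v) →
                        LeafToLeafPath R P → LeafToLeafPath G P
  LeafToLeafPath-lift R⊆G leaf⇒leaf (s , t , mid , refl , (l , u) , s-leaf , t-leaf) =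
    s , t , mid , refl , (Linked.map R⊆G l , u) ,
    leaf⇒leaf (here refl) s-leaf , leaf⇒leaf (there (∈-++⁺ʳ mid (here refl))) t-leaf

-- Deleting a leaf edge

-- Deleting leaf edges keeps the vertex set Fin n, so the induction runs over trees with isolated
-- vertices added.
record SubcubicTreeWithIsolated {n : ℕ} (G : Graph n) : Set where
  field
    connected : ∀ u v → 1 ≤ degree G u → 1 ≤ degree G v → ∃ (PathBetween G u v)
    acyclic   : Acyclic G
    subcubic  : Subcubic G

-- leafCount G is definitionally total (leafInd ∘ degree G).
leafInd : ℕ → ℕ
leafInd d = if ⌊ d ≟ 1 ⌋ then 1 else 0

degreeSum : ∀ {n} → Graph n → ℕ
degreeSum G = total (degree G)

module LeafEdge {n : ℕ} (G : Graph n) {ℓ u : Fin n} (ℓ-leaf : IsLeaf G ℓ) (ℓu : Adj G ℓ u) where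

  R : Graph n
  R = deleteEdge G ℓ u

  R⊆G : R ⊆ᴳ G
  R⊆G = deleteEdge-⊆ G ℓ u

  ℓ≢u : ℓ ≢ u
  ℓ≢u = Adj-irrefl G ℓu

  ℓ-isolated : degree R ℓ ≡ 0
  ℓ-isolated = suc-injective (trans (sym (degree-deleteEdge-start G ℓ u ℓu)) ℓ-leaf)

  degree-u : degree G u ≡ suc (degree R u)
  degree-u = degree-deleteEdge-end G ℓ u ℓu

  degree-other : ∀ {v} → v ≢ ℓ → v ≢ u → degree R v ≡ degree G v
  degree-other = degree-deleteEdge-off G ℓ u

  non-isolated⇒≢ℓ : ∀ {v} → 1 ≤ degree R v → v ≢ ℓ
  non-isolated⇒≢ℓ 1≤d refl with subst (1 ≤_) ℓ-isolated 1≤d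
  ... | ()

  leaf-lift : ∀ {v} → IsLeaf R v → v ≢ u → IsLeaf G v
  leaf-lift leaf v≢u = trans (sym (degree-other (non-isolated⇒≢ℓ (≤-reflexive (sym leaf))) v≢u)) leaf

  degreeSum-< : degreeSum R < degreeSum G
  degreeSum-< =
    total-mono-< ℓ (degree-deleteEdge-≤ G ℓ u) (≤-reflexive (sym (degree-deleteEdge-start G ℓ u ℓu)))

  private
    rest : ℕ
    rest = totalOff ℓ u (leafInd ∘ degree G)

    leafCount-G : leafCount G ≡ suc (leafInd (suc (degree R u)) + rest)
    leafCount-G = begin
      leafCount G                                     ≡⟨ total-split₂ ℓ≢u (leafInd ∘ degree G) ⟩
      leafInd (degree G ℓ) + leafInd (degree G u) + rest
        ≡⟨ cong₂ (λ a b → leafInd a + leafInd b + rest) ℓ-leaf degree-u ⟩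
      suc (leafInd (suc (degree R u)) + rest)         ∎
      where open ≡-Reasoning

    leafCount-R : leafCount R ≡ leafInd (degree R u) + rest
    leafCount-R = begin
      leafCount R                                     ≡⟨ total-split₂ ℓ≢u (leafInd ∘ degree R) ⟩
      leafInd (degree R ℓ) + leafInd (degree R u) + totalOff ℓ u (leafInd ∘ degree R)
        ≡⟨ cong₂ (λ a b → leafInd a + leafInd (degree R u) + b) ℓ-isolated
                 (totalOff-cong λ v v≢ℓ v≢u → cong leafInd (degree-other v≢ℓ v≢u)) ⟩
      leafInd (degree R u) + rest                     ∎
      where open ≡-Reasoning

  leafCount-u-isolated : degree R u ≡ 0 → leafCount G ≡ 2 + leafCount R
  leafCount-u-isolated d rewrite leafCount-G | leafCount-R | d = refl

  leafCount-u-leaf : degree R u ≡ 1 → leafCount G ≡ leafCount R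
  leafCount-u-leaf d rewrite leafCount-G | leafCount-R | d = refl

  leafCount-u-inner : degree R u ≡ 2 → leafCount G ≡ suc (leafCount R)
  leafCount-u-inner d rewrite leafCount-G | leafCount-R | d = refl

  tree : SubcubicTreeWithIsolated G → SubcubicTreeWithIsolated R
  tree T = record
    { connected = connected′
    ; acyclic   = Acyclic-⊆ R⊆G acyclic
    ; subcubic  = λ v → ≤-trans (degree-deleteEdge-≤ G ℓ u v) (subcubic v)
    }
    where
    open SubcubicTreeWithIsolated T
    connected′ : ∀ s t → 1 ≤ degree R s → 1 ≤ degree R t → ∃ (PathBetween R s t)
    connected′ s t 1≤s 1≤t with connected s t (≤-trans 1≤s (degree-deleteEdge-≤ G ℓ u s))
                                              (≤-trans 1≤t (degree-deleteEdge-≤ G ℓ u t))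
    ... | xs , path@((l , unique) , shape) = xs , (Linked-restrict keep (All.tabulate ≢ℓ) l , unique) , shape
      where
      ≢ℓ : ∀ {x} → x ∈ xs → x ≢ ℓ
      ≢ℓ x∈ refl with leaf∈path⇒endpoint G ℓ-leaf path x∈
      ... | inj₁ refl = non-isolated⇒≢ℓ 1≤s refl
      ... | inj₂ refl = non-isolated⇒≢ℓ 1≤t refl
      keep : ∀ {x y} → x ≢ ℓ → y ≢ ℓ → Adj G x y → Adj R x y
      keep x≢ℓ y≢ℓ = deleteEdge-keeps G ℓ u Sum.[ x≢ℓ ∘ proj₁ , y≢ℓ ∘ proj₂ ]

  -- If u is a leaf too, connectivity makes the edge ℓu the whole tree.
  u-isolated⇒leafless : SubcubicTreeWithIsolated G → degree R u ≡ 0 → ∀ {y} → ¬ IsLeaf R y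
  u-isolated⇒leafless T d≡0 {y} y-leaf = byVertex (y ≟ᶠ u) (y ≟ᶠ ℓ)
    where
    degreeOne : ∀ {v} → y ≡ v → degree R v ≡ 1
    degreeOne y≡v = subst (λ v → degree R v ≡ 1) y≡v y-leaf
    byVertex : Dec (y ≡ u) → Dec (y ≡ ℓ) → ⊥
    byVertex (yes y≡u) _         = contradiction (trans (sym d≡0) (degreeOne y≡u)) λ ()
    byVertex (no _)    (yes y≡ℓ) = contradiction (trans (sym ℓ-isolated) (degreeOne y≡ℓ)) λ ()
    byVertex (no y≢u)  (no y≢ℓ)
      with SubcubicTreeWithIsolated.connected T ℓ y (≤-reflexive (sym ℓ-leaf))
                                                 (≤-reflexive (sym (leaf-lift y-leaf y≢u)))
    ... | _ , path = Sum.[ y≢ℓ , y≢u ] (adjacentLeaves-path G ℓ-leaf (trans degree-u (cong suc d≡0)) ℓu path)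

  liftPath : ∀ {P} → (∀ {v} → v ∈ P → IsLeaf R v → v ≢ u) → LeafToLeafPath R P → LeafToLeafPath G P
  liftPath ≢u = LeafToLeafPath-lift {R = R} {G = G} R⊆G λ v∈ leaf → leaf-lift leaf (≢u v∈ leaf)

  liftPaths-u-nonleaf : ∀ {Ps} → ¬ IsLeaf R u → All (LeafToLeafPath R) Ps → All (LeafToLeafPath G) Ps
  liftPaths-u-nonleaf u-nonleaf = All.map (liftPath λ { _ leaf refl → u-nonleaf leaf })

  liftPaths-avoiding-u : ∀ {Ps} → All (u ∉_) Ps → All (LeafToLeafPath R) Ps → All (LeafToLeafPath G) Ps
  liftPaths-avoiding-u avoid ps =
    All.zipWith (λ (u∉P , p) → liftPath (λ { v∈ _ refl → u∉P v∈ }) p) (avoid , ps)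

  Extends : List (Fin n) → List (Fin n) → Set
  Extends Q P = ∀ {x} → x ∈ Q → (x ∈ P × x ≢ ℓ) ⊎ (x ≡ ℓ × u ∈ P)

  Extends-Disjoint : ∀ {P P′ Q Q′} → Extends Q P → Extends Q′ P′ → Disjoint P P′ → Disjoint Q Q′
  Extends-Disjoint ext ext′ P#P′ x x∈Q x∈Q′ with ext x∈Q | ext′ x∈Q′
  ... | inj₁ (x∈P , _)   | inj₁ (x∈P′ , _)   = P#P′ x x∈P x∈P′
  ... | inj₁ (_ , x≢ℓ)   | inj₂ (x≡ℓ , _)    = x≢ℓ x≡ℓ
  ... | inj₂ (x≡ℓ , _)   | inj₁ (_ , x≢ℓ)    = x≢ℓ x≡ℓ
  ... | inj₂ (_ , u∈P)   | inj₂ (_ , u∈P′)   = P#P′ u u∈P u∈P′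

  extendPath : ∀ {P} → LeafToLeafPath R P → ∃ λ Q → LeafToLeafPath G Q × Extends Q P
  extendPath p = extend p (isolated∉LeafToLeafPath R ℓ-isolated p)
    where
    extend : ∀ {P} → LeafToLeafPath R P → ℓ ∉ P → ∃ λ Q → LeafToLeafPath G Q × Extends Q P
    extend {P} (s , t , mid , refl , (l , unique@(s∉ ∷ _)) , s-leaf , t-leaf) ℓ∉P = byEnds (s ≟ᶠ u) (t ≟ᶠ u)
      where
      byEnds : Dec (s ≡ u) → Dec (t ≡ u) → ∃ λ Q → LeafToLeafPath G Q × Extends Q P
      byEnds (yes s≡u) _ =
        ℓ ∷ P , (ℓ , t , s ∷ mid , refl ,
                 (subst (Adj G ℓ) (sym s≡u) ℓu ∷ Linked.map R⊆G l , All.tabulate ℓ≢ ∷ unique) ,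
                 ℓ-leaf , leaf-lift t-leaf λ t≡u → All.lookup s∉ (∈-++⁺ʳ mid (here refl)) (trans s≡u (sym t≡u))) ,
        λ { (here refl) → inj₂ (refl , subst (_∈ P) s≡u (here refl)) ; (there x∈) → inj₁ (x∈ , ℓ≢ x∈ ∘ sym) }
        where
        ℓ≢ : ∀ {x} → x ∈ P → ℓ ≢ x
        ℓ≢ x∈ refl = ℓ∉P x∈
      byEnds (no s≢u) (yes t≡u) =
        P ++ ℓ ∷ [] , (s , ℓ , mid ++ t ∷ [] , refl ,
                       (Linked-snoc (s ∷ mid) (Linked.map R⊆G l) (subst (λ v → Adj G v ℓ) (sym t≡u) (Adj-sym G ℓu)) ,
                        Unique-snoc unique ℓ∉P) ,
                       leaf-lift s-leaf s≢u , ℓ-leaf) ,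
        extends
        where
        extends : Extends (P ++ ℓ ∷ []) P
        extends x∈ with ∈-++⁻ P x∈
        ... | inj₁ x∈P          = inj₁ (x∈P , λ { refl → ℓ∉P x∈P })
        ... | inj₂ (here refl)  = inj₂ (refl , there (∈-++⁺ʳ mid (here (sym t≡u))))
      byEnds (no s≢u) (no t≢u) =
        P , (s , t , mid , refl , (Linked.map R⊆G l , unique) , leaf-lift s-leaf s≢u , leaf-lift t-leaf t≢u) ,
        λ x∈ → inj₁ (x∈ , λ { refl → ℓ∉P x∈ })

  extendPaths : ∀ {Ps} → All (LeafToLeafPath R) Ps → AllPairs Disjoint Ps →
                ∃ λ Qs → length Qs ≡ length Ps × All (LeafToLeafPath G) Qs × AllPairs Disjoint Qs
  extendPaths ps disjoint =
    let Qs , exts , qs = extendAll ps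
    in Qs , Pointwise-length exts , qs , AllPairs-pointwise Extends-Disjoint exts disjoint
    where
    extendAll : ∀ {Ps} → All (LeafToLeafPath R) Ps →
                ∃ λ Qs → Pointwise Extends Qs Ps × All (LeafToLeafPath G) Qs
    extendAll []       = [] , [] , []
    extendAll (p ∷ ps) =
      let Q , q , ext = extendPath p
          Qs , exts , qs = extendAll ps
      in Q ∷ Qs , ext ∷ exts , q ∷ qs

-- Where to prune when the number of leaves is even

data Prunable {n : ℕ} (G : Graph n) : Set where
  pendant : ∀ ℓ u → IsLeaf G ℓ → Adj G ℓ u → degree G u ≤ 2 → Prunable G
  cherry  : ∀ ℓ a u → IsLeaf G ℓ → IsLeaf G a → a ≢ ℓ → Adj G ℓ u → Adj G a u → degree G u ≡ 3 →
            Prunable G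

module _ {n : ℕ} (G : Graph n) (acyclic : Acyclic G) (subcubic : Subcubic G) where

  noChord : ∀ {v pr rest w} → IsPath G (v ∷ pr ∷ rest) → Adj G v w → w ∉ rest
  noChord {v} {pr} {w = w} (l , unique) vw w∈rest with ∈-∃++ w∈rest
  ... | [] , _ , refl =
    acyclic (v ∷ pr ∷ w ∷ [])
      (Unique-prefix (v ∷ pr ∷ []) unique ,
       Linked-snoc (v ∷ pr ∷ []) (Linked-prefix (v ∷ pr ∷ []) l) (Adj-sym G vw))
  ... | p ∷ pre , _ , refl =
    acyclic (v ∷ pr ∷ p ∷ pre ++ w ∷ [])
      (Unique-prefix (v ∷ pr ∷ p ∷ pre) unique ,
       Linked-snoc (v ∷ pr ∷ p ∷ pre) (Linked-prefix (v ∷ pr ∷ p ∷ pre) l) (Adj-sym G vw))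

  private
    leafOf : ∀ {v w} → Adj G v w → ¬ (2 ≤ degree G w) → IsLeaf G w
    leafOf vw ≱2 = ≤-antisym (s≤s⁻¹ (≰⇒> ≱2)) (Adj⇒1≤degree G (Adj-sym G vw))

  -- The walk v ∷ pr ∷ rest is stored backwards from its current end v. Acyclicity keeps it a path,
  -- so it has at most n vertices and the fuel n suffices.
  walk : ∀ fuel v pr rest → n < length (v ∷ pr ∷ rest) + fuel → IsPath G (v ∷ pr ∷ rest) →
         2 ≤ degree G v → Prunable G
  walk zero v pr rest n< path _ =
    contradiction (≤-trans n< (≤-reflexive (+-identityʳ _))) (≤⇒≯ (begin
      length (v ∷ pr ∷ rest)  ≤⟨ Unique-length≤ _ (allFin n) (proj₂ path) (λ {x} _ → ∈-allFin x) ⟩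
      length (allFin n)       ≡⟨ length-tabulate _ ⟩
      n                       ∎))
    where open ≤-Reasoning
  walk (suc fuel) v pr rest n< path@(vpr ∷ l , unique) 2≤d
    with any? (λ w → (Graph.adj G v w ≟ᵇ true) ×-dec ¬? (w ≟ᶠ pr) ×-dec (2 ≤? degree G w))
  ... | yes (w , vw , w≢pr , 2≤dw) =
    walk fuel w v (pr ∷ rest) (≤-trans n< (≤-reflexive (+-suc _ fuel)))
         (Adj-sym G vw ∷ vpr ∷ l , All.tabulate w≢ ∷ unique) 2≤dw
    where
    w≢ : ∀ {x} → x ∈ v ∷ pr ∷ rest → w ≢ x
    w≢ (here refl)         refl = Adj-irrefl G vw refl
    w≢ (there (here refl)) refl = w≢pr refl
    w≢ (there (there x∈))  refl = noChord path vw x∈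
  ... | no ¬forward with anotherNeighbour G 2≤d vpr
  ... | z , z≢pr , vz with leafOf vz (λ 2≤dz → ¬forward (z , vz , z≢pr , 2≤dz)) | degree G v ≟ 2
  ... | z-leaf | yes d≡2 = pendant z v z-leaf (Adj-sym G vz) (≤-reflexive d≡2)
  ... | z-leaf | no d≢2 with thirdNeighbour G (≤∧≢⇒< 2≤d (d≢2 ∘ sym)) vpr vz z≢pr
  ... | c , c≢pr , c≢z , vc =
    cherry z c v z-leaf (leafOf vc λ 2≤dc → ¬forward (c , vc , c≢pr , 2≤dc)) c≢z (Adj-sym G vz) (Adj-sym G vc)
           (≤-antisym (subcubic v) (≤∧≢⇒< 2≤d (d≢2 ∘ sym)))

  findPrunable : ∀ {ℓ} → IsLeaf G ℓ → Prunable G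
  findPrunable {ℓ} ℓ-leaf with 1≤degree⇒Adj G (≤-reflexive (sym ℓ-leaf))
  ... | u , ℓu with degree G u ≤? 2
  ... | yes d≤2 = pendant ℓ u ℓ-leaf ℓu d≤2
  ... | no d≰2  = walk n u ℓ [] (m≤n+m (suc n) 1)
                       (Adj-sym G ℓu ∷ [-] , (Adj-irrefl G ℓu ∘ sym ∷ []) ∷ [] ∷ [])
                       (≤-trans (s≤s (s≤s z≤n)) (≰⇒> d≰2))

-- The induction

module _ {n : ℕ} where

  leafCount≢0⇒leaf : ∀ (G : Graph n) → leafCount G ≢ 0 → ∃ (IsLeaf G)
  leafCount≢0⇒leaf G L≢0 with total≢0 (leafInd ∘ degree G) L≢0
  ... | v , ind≢0 with degree G v ≟ 1
  ...   | yes leaf = v , leaf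
  ...   | no _     = contradiction refl ind≢0

  record Packing (G : Graph n) (x : Fin n) : Set where
    constructor packing
    field
      paths      : List (List (Fin n))
      count      : length paths ≡ ⌊ leafCount G /2⌋
      leafToLeaf : All (LeafToLeafPath G) paths
      disjoint   : AllPairs Disjoint paths
      avoids     : IsLeaf G x → parity (leafCount G) ≡ 1ℙ → All (x ∉_) paths

  emptyPacking : ∀ {G x} → leafCount G ≡ 0 → Packing G x
  emptyPacking L≡0 = packing [] (cong ⌊_/2⌋ (sym L≡0)) [] [] (λ _ _ → [])

  avoids-even : ∀ {G : Graph n} {x Ps} → parity (leafCount G) ≡ 0ℙ →
                IsLeaf G x → parity (leafCount G) ≡ 1ℙ → All (x ∉_) Ps
  avoids-even even _ odd = contradiction (trans (sym even) odd) λ ()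

  module Induction (k : ℕ)
    (IH : ∀ {G : Graph n} → degreeSum G ≤ k → SubcubicTreeWithIsolated G → ∀ x → Packing G x) where

    oddCase : ∀ {G x ℓ} → degreeSum G ≤ suc k → SubcubicTreeWithIsolated G → IsLeaf G ℓ →
              (IsLeaf G x → x ≡ ℓ) → parity (leafCount G) ≡ 1ℙ → Packing G x
    oddCase {G} {x} {ℓ} dk T ℓ-leaf x≡ℓ odd with 1≤degree⇒Adj G (≤-reflexive (sym ℓ-leaf))
    ... | u , ℓu = byDegree (degree R u) refl
      where
      open LeafEdge G ℓ-leaf ℓu

      IH-R : ∀ y → Packing R y
      IH-R = IH (s≤s⁻¹ (≤-trans degreeSum-< dk)) (tree T)

      avoids-ℓ : ∀ {Ps} → All (LeafToLeafPath R) Ps → IsLeaf G x → parity (leafCount G) ≡ 1ℙ → All (x ∉_) Ps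
      avoids-ℓ ps x-leaf _ rewrite x≡ℓ x-leaf = All.map (isolated∉LeafToLeafPath R ℓ-isolated) ps

      byDegree : ∀ d → degree R u ≡ d → Packing G x
      byDegree 0 d≡0 = contradiction (proj₂ (leafCount≢0⇒leaf R L-R≢0)) (u-isolated⇒leafless T d≡0)
        where
        L-R≢0 : leafCount R ≢ 0
        L-R≢0 L≡0 = contradiction (trans (sym odd) (cong parity (trans (leafCount-u-isolated d≡0) (cong (2 +_) L≡0))))
                                  λ ()
      byDegree 1 d≡1 =
        packing paths (trans count (cong ⌊_/2⌋ (sym L≡))) (liftPaths-avoiding-u (avoids d≡1 odd-R) leafToLeaf)
                disjoint (avoids-ℓ leafToLeaf)
        where
        open Packing (IH-R u)
        L≡ : leafCount G ≡ leafCount R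
        L≡ = leafCount-u-leaf d≡1
        odd-R : parity (leafCount R) ≡ 1ℙ
        odd-R = trans (cong parity (sym L≡)) odd
      byDegree 2 d≡2 =
        packing paths count′ (liftPaths-u-nonleaf (λ u-leaf → contradiction (trans (sym d≡2) u-leaf) λ ()) leafToLeaf)
                disjoint (avoids-ℓ leafToLeaf)
        where
        open Packing (IH-R ℓ)
        L≡ : leafCount G ≡ suc (leafCount R)
        L≡ = leafCount-u-inner d≡2
        count′ : length paths ≡ ⌊ leafCount G /2⌋
        count′ = begin
          length paths              ≡⟨ count ⟩
          ⌊ leafCount R /2⌋         ≡⟨ ⌊1+n/2⌋-even _ (trans (parity-pred L≡) (cong _⁻¹ odd)) ⟨
          ⌊ suc (leafCount R) /2⌋   ≡⟨ cong ⌊_/2⌋ L≡ ⟨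
          ⌊ leafCount G /2⌋         ∎
          where open ≡-Reasoning
      byDegree (suc (suc (suc d))) d≡ =
        contradiction (subst (_≤ 3) (trans degree-u (cong suc d≡)) (SubcubicTreeWithIsolated.subcubic T u))
                      λ { (s≤s (s≤s (s≤s ()))) }

    evenCase : ∀ {G x} → degreeSum G ≤ suc k → SubcubicTreeWithIsolated G → Prunable G →
               parity (leafCount G) ≡ 0ℙ → Packing G x
    evenCase {G} dk T (pendant ℓ u ℓ-leaf ℓu d≤2) even = byDegree (degree R u) refl
      where
      open LeafEdge G ℓ-leaf ℓu
      open Packing (IH (s≤s⁻¹ (≤-trans degreeSum-< dk)) (tree T) ℓ)

      byDegree : ∀ d → degree R u ≡ d → Packing G _
      byDegree 0 d≡0 =
        packing ((ℓ ∷ u ∷ []) ∷ paths) (trans (cong suc count) (cong ⌊_/2⌋ (sym (leafCount-u-isolated d≡0))))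
                (edge ∷ liftPaths-u-nonleaf (λ u-leaf → contradiction (trans (sym d≡0) u-leaf) λ ()) leafToLeaf)
                (All.map disjointFromEdge leafToLeaf ∷ disjoint)
                (avoids-even {G = G} even)
        where
        edge : LeafToLeafPath G (ℓ ∷ u ∷ [])
        edge = ℓ , u , [] , refl , (ℓu ∷ [-] , (ℓ≢u ∷ []) ∷ [] ∷ []) , ℓ-leaf , trans degree-u (cong suc d≡0)
        disjointFromEdge : ∀ {P} → LeafToLeafPath R P → Disjoint (ℓ ∷ u ∷ []) P
        disjointFromEdge p _ (here refl)         = isolated∉LeafToLeafPath R ℓ-isolated p
        disjointFromEdge p _ (there (here refl)) = isolated∉LeafToLeafPath R d≡0 p
      byDegree 1 d≡1 =
        let Qs , length≡ , qs , disjointQs = extendPaths leafToLeaf disjoint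
        in packing Qs (trans length≡ (trans count (cong ⌊_/2⌋ (sym (leafCount-u-leaf d≡1))))) qs disjointQs
                   (avoids-even {G = G} even)
      byDegree (suc (suc d)) d≡ =
        contradiction (subst (_≤ 2) (trans degree-u (cong suc d≡)) d≤2) λ { (s≤s (s≤s ())) }
    evenCase {G} dk T (cherry ℓ a u ℓ-leaf a-leaf a≢ℓ ℓu au d≡3) even =
      packing ((ℓ ∷ u ∷ a ∷ []) ∷ paths) count′
              (cherryPath ∷ E₁.liftPaths-avoiding-u avoids-u (E₂.liftPaths-avoiding-u avoids-u leafToLeaf))
              (All.zipWith disjointFromCherry (avoids-u , leafToLeaf) ∷ disjoint)
              (avoids-even {G = G} even)
      where
      module E₁ = LeafEdge G ℓ-leaf ℓu

      a≢u : a ≢ u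
      a≢u a≡u = contradiction (trans (sym a-leaf) (trans (cong (degree G) a≡u) d≡3)) λ ()

      a-leaf₁ : IsLeaf E₁.R a
      a-leaf₁ = trans (E₁.degree-other a≢ℓ a≢u) a-leaf

      au₁ : Adj E₁.R a u
      au₁ = deleteEdge-keeps G ℓ u Sum.[ a≢ℓ ∘ proj₁ , a≢u ∘ proj₁ ] au

      module E₂ = LeafEdge E₁.R a-leaf₁ au₁

      degree-u₁ : degree E₁.R u ≡ 2
      degree-u₁ = suc-injective (trans (sym E₁.degree-u) d≡3)

      degree-u₂ : degree E₂.R u ≡ 1
      degree-u₂ = suc-injective (trans (sym E₂.degree-u) degree-u₁)

      L≡ : leafCount G ≡ suc (leafCount E₂.R)
      L≡ = trans (E₁.leafCount-u-inner degree-u₁) (cong suc (E₂.leafCount-u-leaf degree-u₂))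

      odd₂ : parity (leafCount E₂.R) ≡ 1ℙ
      odd₂ = trans (parity-pred L≡) (cong _⁻¹ even)

      open Packing (IH (s≤s⁻¹ (≤-trans (<-trans E₂.degreeSum-< E₁.degreeSum-<) dk)) (E₂.tree (E₁.tree T)) u)

      avoids-u : All (u ∉_) paths
      avoids-u = avoids degree-u₂ odd₂

      cherryPath : LeafToLeafPath G (ℓ ∷ u ∷ a ∷ [])
      cherryPath = ℓ , a , u ∷ [] , refl ,
                   (ℓu ∷ Adj-sym G au ∷ [-] , (E₁.ℓ≢u ∷ a≢ℓ ∘ sym ∷ []) ∷ (a≢u ∘ sym ∷ []) ∷ [] ∷ []) ,
                   ℓ-leaf , a-leaf

      ℓ-isolated₂ : degree E₂.R ℓ ≡ 0
      ℓ-isolated₂ = trans (E₂.degree-other (a≢ℓ ∘ sym) E₁.ℓ≢u) E₁.ℓ-isolated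

      disjointFromCherry : ∀ {P} → u ∉ P × LeafToLeafPath E₂.R P → Disjoint (ℓ ∷ u ∷ a ∷ []) P
      disjointFromCherry (_ , p)   _ (here refl)                 = isolated∉LeafToLeafPath E₂.R ℓ-isolated₂ p
      disjointFromCherry (u∉P , _) _ (there (here refl))         = u∉P
      disjointFromCherry (_ , p)   _ (there (there (here refl))) = isolated∉LeafToLeafPath E₂.R E₂.ℓ-isolated p

      count′ : length ((ℓ ∷ u ∷ a ∷ []) ∷ paths) ≡ ⌊ leafCount G /2⌋
      count′ = begin
        suc (length paths)             ≡⟨ cong suc count ⟩
        suc ⌊ leafCount E₂.R /2⌋       ≡⟨ ⌊1+n/2⌋-odd _ odd₂ ⟨
        ⌊ suc (leafCount E₂.R) /2⌋     ≡⟨ cong ⌊_/2⌋ L≡ ⟨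
        ⌊ leafCount G /2⌋              ∎
        where open ≡-Reasoning

  packingOf : ∀ k {G : Graph n} → degreeSum G ≤ k → SubcubicTreeWithIsolated G → ∀ x → Packing G x
  packingOf k {G} dk T x with leafCount G ≟ 0
  ... | yes L≡0 = emptyPacking L≡0
  ... | no L≢0 with leafCount≢0⇒leaf G L≢0
  packingOf zero {G} dk T x | no _ | w , w-leaf =
    contradiction (≤-trans (≤-reflexive (sym w-leaf)) (≤-trans (term≤total w (degree G)) dk)) λ ()
  packingOf (suc k) {G} dk T x | no _ | w , w-leaf with parity (leafCount G) in parity≡ | degree G x ≟ 1
  ... | 1ℙ | yes x-leaf   = oddCase dk T x-leaf (λ _ → refl) parity≡
    where open Induction k (packingOf k)
  ... | 1ℙ | no x-nonleaf = oddCase dk T w-leaf (λ x-leaf → contradiction x-leaf x-nonleaf) parity≡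
    where open Induction k (packingOf k)
  ... | 0ℙ | _            = evenCase dk T (findPrunable G acyclic subcubic w-leaf) parity≡
    where open Induction k (packingOf k)
          open SubcubicTreeWithIsolated T using (acyclic; subcubic)

lemma5 : (n : ℕ) (T : Graph n) → IsTree T → Subcubic T →
    Σ (List (List (Fin n))) λ Ps →
      length Ps ≡ leafCount T / 2 × All (LeafToLeafPath T) Ps × AllPairs Disjoint Ps
lemma5 zero    T _                        _        = [] , refl , [] , []
lemma5 (suc n) T (connected , acyclic) subcubic =
  paths , trans count (⌊n/2⌋≡n/2 (leafCount T)) , leafToLeaf , disjoint
  where
  tree : SubcubicTreeWithIsolated T
  tree = record { connected = λ u v _ _ → connected u v ; acyclic = acyclic ; subcubic = subcubic }
  open Packing (packingOf (degreeSum T) ≤-refl tree Fin.zero)
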